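{- Let $\mathcal{S}$ be a string of length $n$, let $i\in[1,n]$, let $\ell=\max_{p\in\mathcal{P}_{i-1}}\mathrm{lce}(p,i)$, and let $j\in\mathcal{P}_{i-1}$ with $\mathrm{lce}(j,i)=\ell$. Assume $\ell\ge 2(i-j)$. Let $\mu=\mathcal{S}[j..i-1]$ and $r_1=j$, $r_2=j+|\mu|=i$. Then for all $a,b\in[0,|\mu|)$ with $a\ne b$: $\mathcal{S}_{r_1+a}\prec\mathcal{S}_{r_1+b}$ if and only if $\mathcal{S}_{r_2+a}\prec\mathcal{S}_{r_2+b}$.
   Context: $\mathcal{S}_k=\mathcal{S}[k..n]$; suffixes compared lexicographically (a proper prefix is smaller); $\mathcal{S}_0$ and $\mathcal{S}_{n+1}$ are artificial suffixes (sentinel smaller than all symbols) smaller than every $\mathcal{S}_k$, $k\in[1,n]$. $\mathrm{pss}[k]=\max\{j\in[0,k):\mathcal{S}_j\prec\mathcal{S}_k\}$. $\mathcal{P}_0=\{0\}$, $\mathcal{P}_k=\{k\}\cup\mathcal{P}_{\mathrm{pss}[k]}$. $\mathrm{lce}(a,b)$ is the length of the longest common prefix of $\mathcal{S}_a$ and $\mathcal{S}_b$. -}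

module Defs where

open import Data.Nat using (ℕ; zero; suc; _<_; _≤_; _∸_; _≟_)
open import Data.List using (List; []; _∷_; drop; length)
open import Data.List.Relation.Binary.Lex.Core using (Lex-<)
open import Data.Product using (_×_)
open import Data.Empty using (⊥)
open import Data.Unit using (⊤)
open import Relation.Binary.PropositionalEquality using (_≡_)
open import Relation.Nullary using (¬_; yes; no)

String : Set
String = List ℕ

-- Suffix S_k = S[k..n] for k ≥ 1 (S_{n+1} is the empty suffix).
suf : String → ℕ → List ℕ
suf S k = drop (k ∸ 1) S

_<lex_ : List ℕ → List ℕ → Set
_<lex_ = Lex-< _≡_ _<_

-- Suffix order S_a ≺ S_b on indices.  S_0 is the artificial suffix,
-- smaller than every other suffix; S_{n+1} is the empty suffix,
-- smaller than every S_k with k ∈ [1,n].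
SufLt : String → ℕ → ℕ → Set
SufLt S zero    zero    = ⊥
SufLt S zero    (suc b) = ⊤
SufLt S (suc a) zero    = ⊥
SufLt S (suc a) (suc b) = suf S (suc a) <lex suf S (suc b)

lcp : List ℕ → List ℕ → ℕ
lcp []       _        = 0
lcp (_ ∷ _)  []       = 0
lcp (x ∷ xs) (y ∷ ys) with x ≟ y
... | yes _ = suc (lcp xs ys)
... | no  _ = 0

-- lce(a,b); S_0 (sentinel) shares no prefix with anything.
lce : String → ℕ → ℕ → ℕ
lce S zero    _       = 0
lce S (suc a) zero    = 0
lce S (suc a) (suc b) = lcp (suf S (suc a)) (suf S (suc b))

IsPss : String → ℕ → ℕ → Set
IsPss S k p = p < k × SufLt S p k × (∀ q → p < q → q < k → ¬ SufLt S q k)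

-- Membership p ∈ P_k, where P_0 = {0}, P_k = {k} ∪ P_{pss[k]}.
data InP (S : String) : ℕ → ℕ → Set where
  here : ∀ {k} → InP S k k
  step : ∀ {k q p} → 1 ≤ k → IsPss S k q → InP S q p → InP S k p

-- S_j and S_i share a prefix of length ℓ ≥ 2m, where m = i − j, so T = S[j..] has period m on
-- its first 2m symbols and every S_{j+c} with c ≤ m agrees with S_{i+c} on m symbols.  If
-- S_{j+a} and S_{j+b} differ within their first m symbols, then S_{i+a} and S_{i+b} differ at
-- the same position in the same way.  Otherwise both start with one word of length m, and
-- cancelling it leaves exactly S_{i+a} against S_{i+b}.  Only lce(j,i) ≥ 2(i − j) is used:
-- neither j ∈ P_{i−1}, the maximality of ℓ, nor a ≢ b plays a role.
module Submission where

open import Defs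
open import Data.Nat using (ℕ; zero; suc; _<_; _≤_; _+_; _*_; _∸_; _⊓_; _≟_; z≤n; s≤s)
open import Data.Nat.Properties
  using (<-irrefl; +-assoc; +-comm; +-identityʳ; +-monoˡ-≤; <⇒≤; n≮0; m≤n⇒m⊓n≡m; m∸n≢0⇒n<m; m+n∸m≡n; m≤n⇒∃[o]m+o≡n)
open import Data.List using (List; []; _∷_; _++_; take; drop; length)
open import Data.List.Properties using (take-take; take-drop; drop-drop; take++drop≡id; ∷-injective; ≡-dec)
open import Data.List.Relation.Binary.Lex.Core using (Lex-<; base; halt; this; next)
open import Data.Product using (_,_)
open import Data.Empty using (⊥-elim)
open import Function.Base using (_∘_)
open import Function.Bundles using (_⇔_; mk⇔)
open import Relation.Binary.Core using (Rel)
open import Relation.Binary.Definitions using (Irreflexive; DecidableEquality)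
open import Relation.Binary.PropositionalEquality
  using (_≡_; _≢_; refl; sym; trans; cong; cong₂; subst; subst₂; module ≡-Reasoning)
open import Relation.Nullary using (yes; no)

take-≡-≤ : ∀ {a} {A : Set a} {c k} (xs ys : List A) → c ≤ k → take k xs ≡ take k ys → take c xs ≡ take c ys
take-≡-≤ {c = c} {k} xs ys c≤k eq = begin
  take c xs           ≡⟨ cong (λ n → take n xs) (sym (m≤n⇒m⊓n≡m c≤k)) ⟩
  take (c ⊓ k) xs     ≡⟨ sym (take-take c k xs) ⟩
  take c (take k xs)  ≡⟨ cong (take c) eq ⟩
  take c (take k ys)  ≡⟨ take-take c k ys ⟩
  take (c ⊓ k) ys     ≡⟨ cong (λ n → take n ys) (m≤n⇒m⊓n≡m c≤k) ⟩
  take c ys           ∎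
  where open ≡-Reasoning

take-lcp : ∀ xs ys → take (lcp xs ys) xs ≡ take (lcp xs ys) ys
take-lcp []       ys       = refl
take-lcp (x ∷ xs) []       = refl
take-lcp (x ∷ xs) (y ∷ ys) with x ≟ y
... | yes refl = cong (x ∷_) (take-lcp xs ys)
... | no  _    = refl

take-drop-periodic : ∀ {a} {A : Set a} (T : List A) m c →
  take (c + m) T ≡ take (c + m) (drop m T) → take m (drop c T) ≡ take m (drop (m + c) T)
take-drop-periodic T m c eq = begin
  take m (drop c T)                ≡⟨ take-drop m c T ⟩
  drop c (take (c + m) T)          ≡⟨ cong (drop c) eq ⟩
  drop c (take (c + m) (drop m T)) ≡⟨ sym (take-drop m c (drop m T)) ⟩
  take m (drop c (drop m T))       ≡⟨ cong (take m) (drop-drop m c T) ⟩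
  take m (drop (m + c) T)          ∎
  where open ≡-Reasoning

module _ {a ℓ} {A : Set a} {_≺_ : Rel A ℓ} where

  private
    _<ₗ_ : Rel (List A) _
    _<ₗ_ = Lex-< _≡_ _≺_

  ++⁺-<lex : ∀ p {xs ys} → xs <ₗ ys → (p ++ xs) <ₗ (p ++ ys)
  ++⁺-<lex []      xs<ys = xs<ys
  ++⁺-<lex (x ∷ p) xs<ys = next refl (++⁺-<lex p xs<ys)

  <lex-determined-by-take : ∀ k {xs ys xs′ ys′} →
    take k xs ≡ take k xs′ → take k ys ≡ take k ys′ → take k xs ≢ take k ys →
    xs <ₗ ys → xs′ <ₗ ys′
  <lex-determined-by-take zero    _ _ ne _ = ⊥-elim (ne refl)
  <lex-determined-by-take (suc k) _ _ _ (base ())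
  <lex-determined-by-take (suc k) {xs′ = []}    {_ ∷ _} _ _ _ halt = halt
  <lex-determined-by-take (suc k) {xs′ = []}    {[]}    _ () _ halt
  <lex-determined-by-take (suc k) {xs′ = _ ∷ _}         () _ _ halt
  <lex-determined-by-take (suc k) {xs′ = []}            () _ _ (this _)
  <lex-determined-by-take (suc k) {xs′ = _ ∷ _} {[]}    _ () _ (this _)
  <lex-determined-by-take (suc k) {xs′ = _ ∷ _} {_ ∷ _} e₁ e₂ _ (this x≺y)
    with refl , _ ← ∷-injective e₁ | refl , _ ← ∷-injective e₂ = this x≺y
  <lex-determined-by-take (suc k) {xs′ = []}            () _ _ (next _ _)
  <lex-determined-by-take (suc k) {xs′ = _ ∷ _} {[]}    _ () _ (next _ _)
  <lex-determined-by-take (suc k) {xs′ = _ ∷ _} {_ ∷ _} e₁ e₂ ne (next refl lt)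
    with refl , e₁′ ← ∷-injective e₁ | refl , e₂′ ← ∷-injective e₂ =
      next refl (<lex-determined-by-take k e₁′ e₂′ (ne ∘ cong (_ ∷_)) lt)

  take-≢⇒<lex⇔ : ∀ k {xs ys xs′ ys′} →
    take k xs ≡ take k xs′ → take k ys ≡ take k ys′ → take k xs ≢ take k ys →
    xs <ₗ ys ⇔ xs′ <ₗ ys′
  take-≢⇒<lex⇔ k e₁ e₂ ne = mk⇔
    (<lex-determined-by-take k e₁ e₂ ne)
    (<lex-determined-by-take k (sym e₁) (sym e₂) (λ e → ne (trans e₁ (trans e (sym e₂)))))

  module _ (≺-irrefl : Irreflexive _≡_ _≺_) where

    ++⁻-<lex : ∀ p {xs ys} → (p ++ xs) <ₗ (p ++ ys) → xs <ₗ ys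
    ++⁻-<lex []      lt          = lt
    ++⁻-<lex (x ∷ p) (this x≺x)  = ⊥-elim (≺-irrefl refl x≺x)
    ++⁻-<lex (x ∷ p) (next _ lt) = ++⁻-<lex p lt

    take-≡⇒<lex⇔drop : ∀ c {xs ys} → take c xs ≡ take c ys → xs <ₗ ys ⇔ drop c xs <ₗ drop c ys
    take-≡⇒<lex⇔drop c {xs} {ys} eq = mk⇔
      (λ lt → ++⁻-<lex (take c xs) (subst₂ _<ₗ_ (sym (take++drop≡id c xs)) ys≡ lt))
      (λ lt → subst₂ _<ₗ_ (take++drop≡id c xs) (sym ys≡) (++⁺-<lex (take c xs) lt))
      where
      ys≡ : ys ≡ take c xs ++ drop c ys
      ys≡ = trans (sym (take++drop≡id c ys)) (cong (_++ drop c ys) (sym eq))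

    <lex-drop-periodic : DecidableEquality A → ∀ (T : List A) m {a b} →
      take (2 * m) T ≡ take (2 * m) (drop m T) → a ≤ m → b ≤ m →
      drop a T <ₗ drop b T ⇔ drop (m + a) T <ₗ drop (m + b) T
    <lex-drop-periodic _≟ᴬ_ T m {a} {b} period a≤m b≤m
      with ≡-dec _≟ᴬ_ (take m (drop a T)) (take m (drop b T))
    ... | no differ = take-≢⇒<lex⇔ m (shift a≤m) (shift b≤m) differ
      where
      shift : ∀ {c} → c ≤ m → take m (drop c T) ≡ take m (drop (m + c) T)
      shift {c} c≤m = take-drop-periodic T m c (take-≡-≤ T (drop m T) c+m≤2m period)
        where
        c+m≤2m : c + m ≤ 2 * m
        c+m≤2m = subst (c + m ≤_) (cong (m +_) (sym (+-identityʳ m))) (+-monoˡ-≤ m c≤m)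
    ... | yes same = subst₂ _⇔_ refl (cong₂ _<ₗ_ (drop-m a) (drop-m b)) (take-≡⇒<lex⇔drop m same)
      where
      drop-m : ∀ c → drop m (drop c T) ≡ drop (m + c) T
      drop-m c = trans (drop-drop c m T) (cong (λ n → drop n T) (+-comm c m))

SufLt-periodic : ∀ S j m {ℓ a b} → 1 ≤ j → lce S j (j + m) ≡ ℓ → 2 * m ≤ ℓ → a ≤ m → b ≤ m →
  SufLt S (j + a) (j + b) ⇔ SufLt S (j + m + a) (j + m + b)
SufLt-periodic S (suc j) m {ℓ} {a} {b} _ lce≡ 2m≤ℓ a≤m b≤m =
  subst₂ _⇔_ (cong₂ _<lex_ (suffix a) (suffix b)) (cong₂ _<lex_ (shifted a) (shifted b))
    (<lex-drop-periodic <-irrefl _≟_ T m period a≤m b≤m)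
  where
  T : List ℕ
  T = drop j S
  suffix : ∀ c → drop c T ≡ drop (j + c) S
  suffix c = drop-drop j c S
  shifted : ∀ c → drop (m + c) T ≡ drop (j + m + c) S
  shifted c = trans (suffix (m + c)) (cong (λ n → drop n S) (sym (+-assoc j m c)))
  period : take (2 * m) T ≡ take (2 * m) (drop m T)
  period = take-≡-≤ T (drop m T) 2m≤ℓ
    (trans (subst (λ n → take n T ≡ take n (drop (j + m) S)) lce≡ (take-lcp T (drop (j + m) S)))
           (cong (take ℓ) (sym (suffix m))))

mainTheorem8 : (S : String) (i j ℓ : ℕ) →
    1 ≤ i → i ≤ length S →
    (∀ p → InP S (i ∸ 1) p → lce S p i ≤ ℓ) →
    InP S (i ∸ 1) j → lce S j i ≡ ℓ →
    2 * (i ∸ j) ≤ ℓ →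
    ∀ a b → a < i ∸ j → b < i ∸ j → a ≢ b →
    (SufLt S (j + a) (j + b) ⇔ SufLt S (i + a) (i + b))
mainTheorem8 S zero    zero _ _ _ _ _ _ _ _ _ () _ _
mainTheorem8 S (suc i) zero _ _ _ _ _ refl () _ _ _ _ _
mainTheorem8 S i (suc j) ℓ _ _ _ _ lce≡ 2m≤ℓ a b a<m b<m _
  with m , refl ← m≤n⇒∃[o]m+o≡n (<⇒≤ (m∸n≢0⇒n<m {i} {suc j} (λ e → n≮0 (subst (a <_) e a<m))))
  rewrite m+n∸m≡n (suc j) m =
    SufLt-periodic S (suc j) m (s≤s z≤n) lce≡ 2m≤ℓ (<⇒≤ a<m) (<⇒≤ b<m)
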